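{- Let $G$ be a module over a principal ideal domain $R$ which has partial decomposition bases $\mathcal{C}$ and $\mathcal{C}'$. Let $X \in \mathcal{C}$ and $Y \in \mathcal{C}'$. Then there are decomposition sets $X'$ and $Y'$ such that $X \subseteq X'$, $Y \subseteq Y'$, $X'$ is the union of an ascending chain of elements of $\mathcal{C}$, $Y'$ is the union of an ascending chain of elements of $\mathcal{C}'$, and $\langle X'\rangle^0 = \langle Y'\rangle^0$.
   Context: For a prime $p$ of $R$, define $p^0G=G$, $p^{\beta+1}G=p(p^\beta G)$, $p^\alpha G=\bigcap_{\beta<\alpha}p^\beta G$ for limit $\alpha$; the $p$-height $|x|_p$ is the ordinal $\alpha$ with $x\in p^\alpha G\setminus p^{\alpha+1}G$, or $\infty$ if none exists. A subset $X\subseteq G$ is a decomposition set if $X$ is an $R$-linearly independent set of elements of infinite order and for all $x_1,\dots,x_n\in X$, $a_1,\dots,a_n\in R$ and every prime $p$ of $R$, $|a_1x_1+\cdots+a_nx_n|_p=\min_{1\le i\le n}|a_ix_i|_p$. For a submodule $K$ of $G$, $K^0=\{x\in G: ax\in K \text{ for some } a\in R\setminus\{0\}\}$; $\langle X\rangle$ denotes the submodule generated by $X$. A partial decomposition basis for $G$ is a collection $\mathcal{C}$ such that (i) $\mathcal{C}$ is a nonempty collection of finite subsets of $G$; (ii) each $X\in\mathcal{C}$ is a decomposition set; (iii) if $X\in\mathcal{C}$ and $x\in G$, there is $Y\in\mathcal{C}$ with $X\subseteq Y$ and $x\in\langle Y\rangle^0$. -}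

module Defs where

open import Level using (Level; _⊔_; Lift) renaming (suc to lsuc)
open import Algebra.Bundles using (CommutativeRing)
open import Algebra.Module.Bundles using (Module)
open import Data.Nat using (ℕ) renaming (suc to nsuc)
open import Data.Unit.Polymorphic using (⊤)
open import Data.Empty using (⊥)
open import Data.Sum using (_⊎_)
open import Data.Product using (Σ; ∃; _×_; _,_; proj₁; proj₂)
open import Data.List using (List; []; _∷_; foldr)
open import Data.List.Relation.Unary.All using (All)
open import Data.List.Relation.Unary.Any using (Any)
open import Data.List.Relation.Unary.AllPairs using (AllPairs)
open import Relation.Nullary using (¬_)
open import Relation.Unary using (Pred)

module _ {c ℓ : Level} (R : CommutativeRing c ℓ) where
  open CommutativeRing R

  _∣R_ : Carrier → Carrier → Set (c ⊔ ℓ)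
  a ∣R b = ∃ λ r → b ≈ r * a

  IsUnit : Carrier → Set (c ⊔ ℓ)
  IsUnit a = a ∣R 1#

  record IsIdeal (I : Pred Carrier (c ⊔ ℓ)) : Set (c ⊔ ℓ) where
    field
      resp  : ∀ {x y} → x ≈ y → I x → I y
      has0  : I 0#
      +-cl  : ∀ {x y} → I x → I y → I (x + y)
      *-cl  : ∀ r {x} → I x → I (r * x)

  IsPrincipal : Pred Carrier (c ⊔ ℓ) → Set (c ⊔ ℓ)
  IsPrincipal I = ∃ λ a → ∀ x → (I x → a ∣R x) × (a ∣R x → I x)

  record IsPID : Set (lsuc (c ⊔ ℓ)) where
    field
      1≉0          : ¬ (1# ≈ 0#)
      noZeroDiv    : ∀ a b → a * b ≈ 0# → (a ≈ 0#) ⊎ (b ≈ 0#)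
      allPrincipal : ∀ (I : Pred Carrier (c ⊔ ℓ)) → IsIdeal I → IsPrincipal I

  record IsPrime (p : Carrier) : Set (c ⊔ ℓ) where
    field
      nonzero : ¬ (p ≈ 0#)
      nonunit : ¬ IsUnit p
      split   : ∀ a b → p ∣R (a * b) → (p ∣R a) ⊎ (p ∣R b)

data Ord (ι : Level) : Set (lsuc ι) where
  ozero : Ord ι
  osuc  : Ord ι → Ord ι
  olim  : (I : Set ι) → (I → Ord ι) → Ord ι

module _ {c ℓ m ℓm : Level} {R : CommutativeRing c ℓ} (G : Module R m ℓm) where
  open CommutativeRing R
  open Module G

  scaleSet : Carrier → Pred Carrierᴹ (m ⊔ ℓm) → Pred Carrierᴹ (m ⊔ ℓm)
  scaleSet p H y = ∃ λ h → H h × (y ≈ᴹ p *ₗ h)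

  pPow : Carrier → Ord m → Pred Carrierᴹ (m ⊔ ℓm)
  pPow p ozero      y = ⊤
  pPow p (osuc α)   y = scaleSet p (pPow p α) y
  pPow p (olim I f) y = ∀ i → pPow p (f i) y

  lc : List (Carrier × Carrierᴹ) → Carrierᴹ
  lc = foldr (λ u acc → (proj₁ u *ₗ proj₂ u) +ᴹ acc) 0ᴹ

  DistinctIn : ∀ {ℓX} → Pred Carrierᴹ ℓX → List (Carrier × Carrierᴹ) → Set (c ⊔ m ⊔ ℓX ⊔ ℓm)
  DistinctIn X l = All (λ u → X (proj₂ u)) l × AllPairs (λ u v → ¬ (proj₂ u ≈ᴹ proj₂ v)) l

  LinIndep : ∀ {ℓX} → Pred Carrierᴹ ℓX → Set (c ⊔ ℓ ⊔ m ⊔ ℓm ⊔ ℓX)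
  LinIndep X = ∀ l → DistinctIn X l → lc l ≈ᴹ 0ᴹ → All (λ u → proj₁ u ≈ 0#) l

  InfiniteOrder : Carrierᴹ → Set (c ⊔ ℓ ⊔ ℓm)
  InfiniteOrder x = ∀ a → ¬ (a ≈ 0#) → ¬ (a *ₗ x ≈ᴹ 0ᴹ)

  -- |a₁x₁+⋯+aₙxₙ|_p = min |aᵢxᵢ|_p, written out via  |y|_p ≥ α ⇔ y ∈ p^α G
  HeightCond : ∀ {ℓX} → Pred Carrierᴹ ℓX → Set (lsuc m ⊔ c ⊔ ℓ ⊔ ℓm ⊔ ℓX)
  HeightCond X = ∀ p → IsPrime R p → ∀ l → DistinctIn X l → ∀ (α : Ord m) →
    (pPow p α (lc l) → All (λ u → pPow p α (proj₁ u *ₗ proj₂ u)) l) ×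
    (All (λ u → pPow p α (proj₁ u *ₗ proj₂ u)) l → pPow p α (lc l))

  record IsDecompositionSet {ℓX} (X : Pred Carrierᴹ ℓX) : Set (lsuc m ⊔ c ⊔ ℓ ⊔ ℓm ⊔ ℓX) where
    field
      linIndep : LinIndep X
      infOrder : ∀ x → X x → InfiniteOrder x
      heights  : HeightCond X

  -- a finite subset given by a list, viewed as a predicate (membership up to ≈ᴹ)
  ⟦_⟧ : List Carrierᴹ → Pred Carrierᴹ (m ⊔ ℓm)
  ⟦ xs ⟧ y = Any (λ x → y ≈ᴹ x) xs

  Span : ∀ {ℓX} → Pred Carrierᴹ ℓX → Pred Carrierᴹ (c ⊔ m ⊔ ℓm ⊔ ℓX)
  Span X y = ∃ λ l → All (λ u → X (proj₂ u)) l × (y ≈ᴹ lc l)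

  Purify : ∀ {ℓK} → Pred Carrierᴹ ℓK → Pred Carrierᴹ (c ⊔ ℓ ⊔ ℓK)
  Purify K x = ∃ λ a → ¬ (a ≈ 0#) × K (a *ₗ x)

  _⊆ₚ_ : ∀ {ℓ₁ ℓ₂} → Pred Carrierᴹ ℓ₁ → Pred Carrierᴹ ℓ₂ → Set (m ⊔ ℓ₁ ⊔ ℓ₂)
  A ⊆ₚ B = ∀ x → A x → B x

  record IsPartialDecompositionBasis {ℓC} (C : Pred (List Carrierᴹ) ℓC)
         : Set (lsuc m ⊔ c ⊔ ℓ ⊔ ℓm ⊔ ℓC) where
    field
      nonempty : ∃ λ X → C X
      decomp   : ∀ X → C X → IsDecompositionSet ⟦ X ⟧
      extend   : ∀ X → C X → ∀ x → ∃ λ Y → C Y × (⟦ X ⟧ ⊆ₚ ⟦ Y ⟧) × Purify (Span ⟦ Y ⟧) x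

  IsUnionOfChain : ∀ {ℓC ℓX} → Pred (List Carrierᴹ) ℓC → Pred Carrierᴹ ℓX
                   → Set (m ⊔ ℓm ⊔ ℓC ⊔ ℓX)
  IsUnionOfChain C X' = Σ (ℕ → List Carrierᴹ) λ ch →
    (∀ n → C (ch n)) × (∀ n → ⟦ ch n ⟧ ⊆ₚ ⟦ ch (nsuc n) ⟧) ×
    (X' ⊆ₚ (λ y → ∃ λ n → ⟦ ch n ⟧ y)) × ((λ y → ∃ λ n → ⟦ ch n ⟧ y) ⊆ₚ X')

module Submission where

-- Back-and-forth between two partial decomposition bases.
--
-- Write PS Z = ⟨Z⟩⁰ for the purification of the span of Z.  Starting from
-- X₀ = X and Y₀ = Y we build ascending chains X₀ ⊆ X₁ ⊆ ⋯ in C and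
-- Y₀ ⊆ Y₁ ⊆ ⋯ in C' by alternately extending: Yₙ₊₁ ⊇ Yₙ is chosen in C'
-- with Xₙ ⊆ PS Yₙ₊₁, and then Xₙ₊₁ ⊇ Xₙ is chosen in C with
-- Yₙ₊₁ ⊆ PS Xₙ₊₁ (axiom (iii), applied once per element of a finite set).
-- The unions X' and Y' then satisfy X' ⊆ PS Y' and Y' ⊆ PS X', and since
-- PS is a closure operator this gives PS X' = PS Y'.

open import Defs
open import Level using (Level; _⊔_)
open import Algebra.Bundles using (CommutativeRing)
open import Algebra.Module.Bundles using (Module)
open import Data.Nat using (ℕ; zero; suc; _≤′_; ≤′-refl; ≤′-step) renaming (_⊔_ to _⊔ℕ_)
open import Data.Nat.Properties using (≤⇒≤′; m≤m⊔n; m≤n⊔m)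
open import Data.List using (List; []; _∷_; _++_; map)
open import Data.List.Relation.Unary.All as All using (All; []; _∷_)
open import Data.List.Relation.Unary.All.Properties using (++⁺; map⁺)
open import Data.List.Relation.Unary.Any using (here; there)
open import Data.Product using (Σ; ∃; _×_; _,_; proj₁; proj₂; map₁)
open import Data.Sum using (inj₁; inj₂)
open import Relation.Nullary using (¬_)
open import Relation.Unary using (Pred)

module PureSpans {c ℓ m ℓm : Level} {R : CommutativeRing c ℓ} (pid : IsPID R)
                 (G : Module R m ℓm) where
  open CommutativeRing R hiding (zero)
  open Module G
  open IsPID pid

  M : Set m
  M = Carrierᴹ

  infix 4 _⊆_
  _⊆_ : ∀ {ℓ₁ ℓ₂} → Pred M ℓ₁ → Pred M ℓ₂ → Set (m ⊔ ℓ₁ ⊔ ℓ₂)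
  _⊆_ = _⊆ₚ_ G

  PS : ∀ {z} → Pred M z → Pred M (c ⊔ ℓ ⊔ m ⊔ ℓm ⊔ z)
  PS Z = Purify G (Span G Z)

  record IsSubmodule {q} (Q : Pred M q) : Set (c ⊔ m ⊔ ℓm ⊔ q) where
    field
      resp : ∀ {x y} → x ≈ᴹ y → Q x → Q y
      has0 : Q 0ᴹ
      plus : ∀ {x y} → Q x → Q y → Q (x +ᴹ y)
      scal : ∀ r {x} → Q x → Q (r *ₗ x)

  DrawnFrom : ∀ {z} → Pred M z → List (Carrier × M) → Set (c ⊔ m ⊔ z)
  DrawnFrom Z = All (λ u → Z (proj₂ u))

  lc-++ : ∀ l₁ l₂ → lc G (l₁ ++ l₂) ≈ᴹ lc G l₁ +ᴹ lc G l₂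
  lc-++ []              l₂ = ≈ᴹ-sym (+ᴹ-identityˡ _)
  lc-++ ((a , x) ∷ l₁) l₂ =
    ≈ᴹ-trans (+ᴹ-congˡ (lc-++ l₁ l₂)) (≈ᴹ-sym (+ᴹ-assoc _ _ _))

  lc-scale : ∀ r l → lc G (map (map₁ (r *_)) l) ≈ᴹ r *ₗ lc G l
  lc-scale r []            = ≈ᴹ-sym (*ₗ-zeroʳ r)
  lc-scale r ((a , x) ∷ l) =
    ≈ᴹ-trans (+ᴹ-cong (*ₗ-assoc r a x) (lc-scale r l)) (≈ᴹ-sym (*ₗ-distribˡ r _ _))

  Span-isSubmodule : ∀ {z} (Z : Pred M z) → IsSubmodule (Span G Z)
  Span-isSubmodule Z = record
    { resp = λ { x≈y (l , from , e) → l , from , ≈ᴹ-trans (≈ᴹ-sym x≈y) e }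
    ; has0 = [] , [] , ≈ᴹ-refl
    ; plus = λ { (l₁ , f₁ , e₁) (l₂ , f₂ , e₂) →
        l₁ ++ l₂ , ++⁺ f₁ f₂ , ≈ᴹ-trans (+ᴹ-cong e₁ e₂) (≈ᴹ-sym (lc-++ l₁ l₂)) }
    ; scal = λ { r (l , from , e) →
        map (map₁ (r *_)) l , map⁺ from , ≈ᴹ-trans (*ₗ-congˡ e) (≈ᴹ-sym (lc-scale r l)) }
    }

  Span-least : ∀ {z q} {Z : Pred M z} {Q : Pred M q} →
               IsSubmodule Q → Z ⊆ Q → Span G Z ⊆ Q
  Span-least {Z = Z} {Q} sub Z⊆Q y (l , from , e) = resp (≈ᴹ-sym e) (combination l from)
    where
    open IsSubmodule sub
    combination : ∀ l → DrawnFrom Z l → Q (lc G l)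
    combination []            []          = has0
    combination ((a , x) ∷ l) (zx ∷ from) = plus (scal a (Z⊆Q x zx)) (combination l from)

  Span-mono : ∀ {z w} {Z : Pred M z} {W : Pred M w} → Z ⊆ W → Span G Z ⊆ Span G W
  Span-mono Z⊆W y (l , from , e) = l , All.map (λ {u} → Z⊆W (proj₂ u)) from , e

  Purify-mono : ∀ {z w} {Z : Pred M z} {W : Pred M w} → Z ⊆ W → Purify G Z ⊆ Purify G W
  Purify-mono Z⊆W y (a , a≉0 , p) = a , a≉0 , Z⊆W _ p

  nonzero-* : ∀ {a b} → ¬ (a ≈ 0#) → ¬ (b ≈ 0#) → ¬ (a * b ≈ 0#)
  nonzero-* a≉0 b≉0 ab≈0 with noZeroDiv _ _ ab≈0
  ... | inj₁ a≈0 = a≉0 a≈0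
  ... | inj₂ b≈0 = b≉0 b≈0

  scale-swap : ∀ a b x → (a * b) *ₗ x ≈ᴹ b *ₗ (a *ₗ x)
  scale-swap a b x = ≈ᴹ-trans (*ₗ-congʳ (*-comm a b)) (*ₗ-assoc b a x)

  Purify-isSubmodule : ∀ {q} {Q : Pred M q} → IsSubmodule Q → IsSubmodule (Purify G Q)
  Purify-isSubmodule sub = record
    { resp = λ { x≈y (a , a≉0 , p) → a , a≉0 , resp (*ₗ-congˡ x≈y) p }
    ; has0 = 1# , 1≉0 , resp (≈ᴹ-sym (*ₗ-zeroʳ 1#)) has0
    ; plus = λ { {x} {y} (a , a≉0 , p) (b , b≉0 , q) → a * b , nonzero-* a≉0 b≉0 ,
        resp (≈ᴹ-sym (≈ᴹ-trans (*ₗ-distribˡ (a * b) x y)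
                                (+ᴹ-congˡ (*ₗ-assoc a b y))))
             (plus (resp (≈ᴹ-sym (scale-swap a b x)) (scal b p)) (scal a q)) }
    ; scal = λ { r {x} (a , a≉0 , p) → a , a≉0 ,
        resp (≈ᴹ-trans (≈ᴹ-sym (scale-swap a r x)) (*ₗ-assoc a r x)) (scal r p) }
    }
    where open IsSubmodule sub

  PS-isSubmodule : ∀ {z} (Z : Pred M z) → IsSubmodule (PS Z)
  PS-isSubmodule Z = Purify-isSubmodule (Span-isSubmodule Z)

  PS-mono : ∀ {z w} {Z : Pred M z} {W : Pred M w} → Z ⊆ W → PS Z ⊆ PS W
  PS-mono Z⊆W = Purify-mono (Span-mono Z⊆W)

  PS-least : ∀ {a b} {A : Pred M a} {B : Pred M b} → A ⊆ PS B → PS A ⊆ PS B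
  PS-least {B = B} A⊆PSB y p with Purify-mono (Span-least (PS-isSubmodule B) A⊆PSB) y p
  ... | b , b≉0 , (a , a≉0 , q) =
    a * b , nonzero-* a≉0 b≉0 , IsSubmodule.resp (Span-isSubmodule B) (≈ᴹ-sym (*ₗ-assoc a b y)) q

  finiteCharacter : ∀ {x d} (X : Pred M x) →
    (∀ l → DrawnFrom X l → ∃ λ (D : Pred M d) → IsDecompositionSet G D × DrawnFrom D l) →
    IsDecompositionSet G X
  finiteCharacter X local = record
    { linIndep = λ l (from , distinct) → IsDecompositionSet.linIndep (dec l from) l (inD l from , distinct)
    ; infOrder = λ x Xx → IsDecompositionSet.infOrder (dec ((1# , x) ∷ []) (Xx ∷ []))
                            x (All.head (inD ((1# , x) ∷ []) (Xx ∷ [])))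
    ; heights  = λ p prime l (from , distinct) →
        IsDecompositionSet.heights (dec l from) p prime l (inD l from , distinct)
    }
    where
    dec : ∀ l (from : DrawnFrom X l) → IsDecompositionSet G (proj₁ (local l from))
    dec l from = proj₁ (proj₂ (local l from))
    inD : ∀ l (from : DrawnFrom X l) → DrawnFrom (proj₁ (local l from)) l
    inD l from = proj₂ (proj₂ (local l from))

  module ChainUnion (ch : ℕ → List M) (ascending : ∀ n → ⟦_⟧ G (ch n) ⊆ ⟦_⟧ G (ch (suc n))) where

    ⋃ch : Pred M (m ⊔ ℓm)
    ⋃ch y = ∃ λ n → ⟦_⟧ G (ch n) y

    ascending* : ∀ {n k} → n ≤′ k → ⟦_⟧ G (ch n) ⊆ ⟦_⟧ G (ch k)
    ascending* ≤′-refl      y p = p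
    ascending* (≤′-step le) y p = ascending _ y (ascending* le y p)

    singleStage : ∀ l → DrawnFrom ⋃ch l → ∃ λ N → DrawnFrom (⟦_⟧ G (ch N)) l
    singleStage []      []               = 0 , []
    singleStage (u ∷ l) ((n , p) ∷ from) with singleStage l from
    ... | N , from′ = n ⊔ℕ N , ascending* (≤⇒≤′ (m≤m⊔n n N)) _ p
                             ∷ All.map (λ {v} → ascending* (≤⇒≤′ (m≤n⊔m n N)) (proj₂ v)) from′

    ⋃ch-decomposition : (∀ n → IsDecompositionSet G (⟦_⟧ G (ch n))) → IsDecompositionSet G ⋃ch
    ⋃ch-decomposition dec = finiteCharacter ⋃ch λ l from →
      let (N , inN) = singleStage l from in ⟦_⟧ G (ch N) , dec N , inN

  record Cover {ℓC} (C : Pred (List M) ℓC) (Z xs : List M) : Set (c ⊔ ℓ ⊔ m ⊔ ℓm ⊔ ℓC) where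
    field
      list   : List M
      inC    : C list
      grows  : ⟦_⟧ G Z ⊆ ⟦_⟧ G list
      covers : ⟦_⟧ G xs ⊆ PS (⟦_⟧ G list)

  cover : ∀ {ℓC} {C : Pred (List M) ℓC} → IsPartialDecompositionBasis G C →
          ∀ Z → C Z → ∀ xs → Cover C Z xs
  cover B Z cZ []       = record { list = Z ; inC = cZ ; grows = λ _ p → p ; covers = λ _ () }
  cover B Z cZ (x ∷ xs) with cover B Z cZ xs
  ... | record { list = Z₁ ; inC = c₁ ; grows = g₁ ; covers = cov₁ }
      with IsPartialDecompositionBasis.extend B Z₁ c₁ x
  ... | Z₂ , c₂ , g₂ , x∈PS = record
    { list = Z₂ ; inC = c₂ ; grows = λ y p → g₂ y (g₁ y p) ; covers = covers′ }
    where
    covers′ : ⟦_⟧ G (x ∷ xs) ⊆ PS (⟦_⟧ G Z₂)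
    covers′ y (here y≈x) = IsSubmodule.resp (PS-isSubmodule _) (≈ᴹ-sym y≈x) x∈PS
    covers′ y (there p)  = PS-mono g₂ y (cov₁ y p)

  module Zigzag {ℓC ℓC'} {C : Pred (List M) ℓC} {C' : Pred (List M) ℓC'}
                (B : IsPartialDecompositionBasis G C) (B' : IsPartialDecompositionBasis G C')
                (X Y : List M) (cX : C X) (cY : C' Y) where

    record Stage : Set (m ⊔ ℓC ⊔ ℓC') where
      field
        xs : List M
        ys : List M
        cx : C xs
        cy : C' ys
    open Stage

    coverY : (s : Stage) → Cover C' (ys s) (xs s)
    coverY s = cover B' (ys s) (cy s) (xs s)

    coverX : (s : Stage) → Cover C (xs s) (Cover.list (coverY s))
    coverX s = cover B (xs s) (cx s) (Cover.list (coverY s))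

    stage : ℕ → Stage
    stage zero    = record { xs = X ; ys = Y ; cx = cX ; cy = cY }
    stage (suc n) = record { xs = Cover.list (coverX (stage n)) ; ys = Cover.list (coverY (stage n))
                           ; cx = Cover.inC (coverX (stage n)) ; cy = Cover.inC (coverY (stage n)) }

    module UX = ChainUnion (λ n → xs (stage n)) (λ n → Cover.grows (coverX (stage n)))
    module UY = ChainUnion (λ n → ys (stage n)) (λ n → Cover.grows (coverY (stage n)))

    X' Y' : Pred M (m ⊔ ℓm)
    X' = UX.⋃ch
    Y' = UY.⋃ch

    X'-chain : IsUnionOfChain G C X'
    X'-chain = (λ n → xs (stage n)) , (λ n → cx (stage n)) ,
               (λ n → Cover.grows (coverX (stage n))) , (λ _ p → p) , (λ _ p → p)

    Y'-chain : IsUnionOfChain G C' Y'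
    Y'-chain = (λ n → ys (stage n)) , (λ n → cy (stage n)) ,
               (λ n → Cover.grows (coverY (stage n))) , (λ _ p → p) , (λ _ p → p)

    X'-decomposition : IsDecompositionSet G X'
    X'-decomposition = UX.⋃ch-decomposition (λ n → IsPartialDecompositionBasis.decomp B _ (cx (stage n)))

    Y'-decomposition : IsDecompositionSet G Y'
    Y'-decomposition = UY.⋃ch-decomposition (λ n → IsPartialDecompositionBasis.decomp B' _ (cy (stage n)))

    -- Xₙ ⊆ PS Yₙ₊₁ ⊆ PS Y'
    X'⊆PS-Y' : X' ⊆ PS Y'
    X'⊆PS-Y' y (n , p) = PS-mono (λ _ q → suc n , q) y (Cover.covers (coverY (stage n)) y p)

    -- Yₙ ⊆ Yₙ₊₁ ⊆ PS Xₙ₊₁ ⊆ PS X'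
    Y'⊆PS-X' : Y' ⊆ PS X'
    Y'⊆PS-X' y (n , p) = PS-mono (λ _ q → suc n , q) y
      (Cover.covers (coverX (stage n)) y (Cover.grows (coverY (stage n)) y p))

theorem6 : ∀ {c ℓ m ℓm ℓC ℓC'} (R : CommutativeRing c ℓ) → IsPID R →
    (G : Module R m ℓm) →
    (C : Pred (List (Module.Carrierᴹ G)) ℓC) → (C' : Pred (List (Module.Carrierᴹ G)) ℓC') →
    IsPartialDecompositionBasis G C → IsPartialDecompositionBasis G C' →
    ∀ X Y → C X → C' Y →
    Σ (Pred (Module.Carrierᴹ G) (m ⊔ ℓm)) λ X' → Σ (Pred (Module.Carrierᴹ G) (m ⊔ ℓm)) λ Y' →
      IsDecompositionSet G X' × IsDecompositionSet G Y' ×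
      _⊆ₚ_ G (⟦_⟧ G X) X' × _⊆ₚ_ G (⟦_⟧ G Y) Y' ×
      IsUnionOfChain G C X' × IsUnionOfChain G C' Y' ×
      _⊆ₚ_ G (Purify G (Span G X')) (Purify G (Span G Y')) ×
      _⊆ₚ_ G (Purify G (Span G Y')) (Purify G (Span G X'))
theorem6 R pid G C C' B B' X Y cX cY =
  X' , Y' , X'-decomposition , Y'-decomposition ,
  (λ _ p → 0 , p) , (λ _ p → 0 , p) ,
  X'-chain , Y'-chain ,
  PS-least X'⊆PS-Y' , PS-least Y'⊆PS-X'
  where
  open PureSpans pid G
  open Zigzag B B' X Y cX cY
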